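{- Let $E$ be a finite set and $\tau:2^{E}\to2^{E}$ an operator satisfying (C1) $X\subseteq\tau(X)$ for all $X\subseteq E$, and (C22) for all $F\subseteq G\subseteq E$ with $G\subseteq\tau(F)$, $\tau(G)=\tau(F)$ (a violator space), and suppose $(E,\tau)$ is uniquely generated. Call $X,Y\subseteq E$ equivalent if $\tau(X)=\tau(Y)$. Then the partition of $2^{E}$ into equivalence classes is a hypercube partition of $2^{E}$; more precisely, for every $A\subseteq E$ the class $\{X\subseteq E:\tau(X)=\tau(A)\}$ equals the interval $[B_A,\tau(A)]$, where $B_A$ is the unique basis of $A$.
   Context: For sets $A\subseteq B\subseteq E$, the interval $[A,B]$ is $\{C\subseteq E: A\subseteq C\subseteq B\}$. A hypercube partition of $2^{E}$ (the vertex set of the hypercube on $E$) is a partition of $2^{E}$ into pairwise disjoint intervals. A generator of $X$ is any $B\subseteq E$ with $\tau(B)=\tau(X)$; a basis of $X$ is an inclusion-minimal generator of $X$; $(E,\tau)$ is uniquely generated if every $X\subseteq E$ has exactly one basis. -}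

module Defs where

open import Data.Nat using (ℕ)
open import Data.Fin.Subset using (Subset; _⊆_; _∈_)
open import Data.Product using (Σ; _×_; ∃-syntax)
open import Relation.Binary.PropositionalEquality using (_≡_)
open import Relation.Nullary using (¬_)

-- Ground set E = Fin n; subsets of E are  Subset n ; an operator is τ : Subset n → Subset n.
Operator : ℕ → Set
Operator n = Subset n → Subset n

C1 : ∀ {n} → Operator n → Set
C1 {n} τ = (X : Subset n) → X ⊆ τ X

C22 : ∀ {n} → Operator n → Set
C22 {n} τ = (F G : Subset n) → F ⊆ G → G ⊆ τ F → τ G ≡ τ F

ViolatorSpace : ∀ {n} → Operator n → Set
ViolatorSpace τ = C1 τ × C22 τ

Generator : ∀ {n} → Operator n → Subset n → Subset n → Set
Generator τ X B = τ B ≡ τ X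

Basis : ∀ {n} → Operator n → Subset n → Subset n → Set
Basis {n} τ X B = Generator τ X B × ((C : Subset n) → C ⊆ B → Generator τ X C → C ≡ B)

UniquelyGenerated : ∀ {n} → Operator n → Set
UniquelyGenerated {n} τ =
  (X : Subset n) → ∃[ B ] (Basis τ X B × ((B' : Subset n) → Basis τ X B' → B' ≡ B))

InInterval : ∀ {n} → Subset n → Subset n → Subset n → Set
InInterval A B C = A ⊆ C × C ⊆ B

Equivalent : ∀ {n} → Operator n → Subset n → Subset n → Set
Equivalent τ X Y = τ X ≡ τ Y

HypercubePartition : ∀ {n} → (Subset n → Subset n → Set) → Set
HypercubePartition {n} Cl =
  ((X : Subset n) → Cl X X)
  × ((X : Subset n) → ∃[ L ] ∃[ U ] (L ⊆ U × ((Y : Subset n) → (Cl X Y → InInterval L U Y) × (InInterval L U Y → Cl X Y))))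
  × ((X Y : Subset n) → (∃[ Z ] (Cl X Z × Cl Y Z)) → (W : Subset n) → (Cl X W → Cl Y W) × (Cl Y W → Cl X W))

-- Every generator of X contains a basis of X (shrink it while some proper subset still
-- generates), so under unique generation every generator contains the basis B_X; and
-- every generator lies in τ(X) by (C1). Conversely a set squeezed between B_X and τ(X)
-- generates X by (C22). So the class of X is exactly [B_X, τ(X)], and classes of an
-- equivalence that are intervals form a hypercube partition.
module Submission where

open import Defs
open import Data.Nat using (ℕ)
open import Data.Fin.Subset using (Subset; _⊆_; _⊂_; _∈_)
open import Data.Fin.Subset.Properties using (_⊂?_; _∈?_; ⊆-antisym; ⊆-trans; anySubset?)
open import Data.Fin.Subset.Induction using (Acc; acc; ⊂-wellFounded)
open import Data.Bool.Properties using () renaming (_≟_ to _≟ᵇ_)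
open import Data.Vec.Properties using (≡-dec)
open import Data.Product using (_×_; _,_; proj₁; ∃-syntax)
open import Data.Empty using (⊥-elim)
open import Function using (id)
open import Relation.Nullary using (Dec; yes; no; ¬_)
open import Relation.Nullary.Decidable using (_×-dec_)
open import Relation.Binary.PropositionalEquality using (_≡_; refl; sym; trans; subst)

_≟ˢ_ : ∀ {n} (p q : Subset n) → Dec (p ≡ q)
_≟ˢ_ = ≡-dec _≟ᵇ_

⊆∧⊄⇒≡ : ∀ {n} {p q : Subset n} → p ⊆ q → ¬ (p ⊂ q) → p ≡ q
⊆∧⊄⇒≡ {p = p} {q} p⊆q p⊄q = ⊆-antisym p⊆q q⊆p
  where
  q⊆p : q ⊆ p
  q⊆p {x} x∈q with x ∈? p
  ... | yes x∈p = x∈p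
  ... | no  x∉p = ⊥-elim (p⊄q (p⊆q , x , x∈q , x∉p))

ClassIsInterval : ∀ {n} → Operator n → Subset n → Subset n → Subset n → Set
ClassIsInterval {n} τ A L U =
  L ⊆ U × ((X : Subset n) → (τ X ≡ τ A → InInterval L U X) × (InInterval L U X → τ X ≡ τ A))

module _ {n : ℕ} (τ : Operator n) where

  generator⇒⊇someBasis : ∀ {A C} → Generator τ A C → ∃[ B ] (Basis τ A B × B ⊆ C)
  generator⇒⊇someBasis {A} = shrink (⊂-wellFounded _)
    where
    shrink : ∀ {C} → Acc _⊂_ C → Generator τ A C → ∃[ B ] (Basis τ A B × B ⊆ C)
    shrink {C} (acc smaller) genC
      with anySubset? (λ D → (D ⊂? C) ×-dec (τ D ≟ˢ τ A))
    ... | yes (D , D⊂C , genD) =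
      let B , basisB , B⊆D = shrink (smaller D⊂C) genD
      in  B , basisB , ⊆-trans B⊆D (proj₁ D⊂C)
    ... | no noSmallerGenerator =
      C , (genC , λ D D⊆C genD → ⊆∧⊄⇒≡ D⊆C (λ D⊂C → noSmallerGenerator (D , D⊂C , genD))) , id

  generator⇒⊇basis : UniquelyGenerated τ → ∀ {A B C} →
                     Basis τ A B → Generator τ A C → B ⊆ C
  generator⇒⊇basis unique {A} {B} {C} basisB genC =
    let B′ , basisB′ , B′⊆C = generator⇒⊇someBasis genC
        _ , _ , onlyBasis = unique A
    in  subst (_⊆ C) (trans (onlyBasis B′ basisB′) (sym (onlyBasis B basisB))) B′⊆C

  generator⊆closure : C1 τ → ∀ {A C} → Generator τ A C → C ⊆ τ A
  generator⊆closure extensive {C = C} genC x∈C = subst (_ ∈_) genC (extensive C x∈C)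

  inInterval⇒generator : C22 τ → ∀ {A B X} →
                         Generator τ A B → InInterval B (τ A) X → Generator τ A X
  inInterval⇒generator c22 {B = B} {X} genB (B⊆X , X⊆τA) =
    trans (c22 B X B⊆X (subst (X ⊆_) (sym genB) X⊆τA)) genB

  basis-classIsInterval : ViolatorSpace τ → UniquelyGenerated τ → ∀ {A B} →
                          Basis τ A B → ClassIsInterval τ A B (τ A)
  basis-classIsInterval (c1 , c22) unique basisB@(genB , _) =
    generator⊆closure c1 genB ,
    λ X → (λ genX → generator⇒⊇basis unique basisB genX , generator⊆closure c1 genX)
        , inInterval⇒generator c22 genB

  intervalClasses⇒hypercubePartition :
    ((A : Subset n) → ∃[ L ] ∃[ U ] ClassIsInterval τ A L U) → HypercubePartition (Equivalent τ)
  intervalClasses⇒hypercubePartition classIsInterval =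
    (λ _ → refl) ,
    (λ A → let L , U , L⊆U , sameClass = classIsInterval A
           in  L , U , L⊆U , λ X → let to , from = sameClass X
                                   in  (λ eq → to (sym eq)) , (λ inI → sym (from inI))) ,
    (λ A A′ (_ , AZ , A′Z) _ → trans (trans A′Z (sym AZ)) , trans (trans AZ (sym A′Z)))

mainTheorem16 : (n : ℕ) (τ : Operator n) → ViolatorSpace τ → UniquelyGenerated τ →
    HypercubePartition (Equivalent τ)
    × ((A B : Subset n) → Basis τ A B →
        B ⊆ τ A × ((X : Subset n) → (τ X ≡ τ A → InInterval B (τ A) X) × (InInterval B (τ A) X → τ X ≡ τ A)))
mainTheorem16 n τ violator unique =
  intervalClasses⇒hypercubePartition τ
    (λ A → let B , basisB , _ = unique A in B , τ A , basis-classIsInterval τ violator unique basisB) ,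
  λ A B → basis-classIsInterval τ violator unique
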